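{- Let $\Phi$ be a CNF formula on variables $x_1,\dots,x_n$ and $x$ a variable such that $\Phi$ has satisfying assignments with $x=T$ and with $x=F$. Run the coupling procedure described in the context on $\Phi$ and $x$ (with any fixed marking of variables and any fixed rule for choosing clauses), and consider its state at termination. Let $\mathcal{C}_I$ (resp. $\mathcal{C}_O$) be the set of remaining (non-deleted) clauses all of whose variables lie in $V_I$ (resp. $V_O$), $\Phi'_I=\bigwedge_{c\in\mathcal{C}_I}c$, $\Phi'_O=\bigwedge_{c\in\mathcal{C}_O}c$. Let $\Phi_{I_i}$ be the simplification of $\Phi'_I$ with respect to $\mathcal{A}_i$ ($i=1,2$), and let $\Phi_O$ be the simplification of $\Phi'_O$ with respect to $\mathcal{A}_1$ (which equals its simplification with respect to $\mathcal{A}_2$). Then $\Phi_{\mathcal{A}_1} = \Phi_{I_1}\wedge\Phi_O$ and $\Phi_{\mathcal{A}_2}=\Phi_{I_2}\wedge\Phi_O$.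
   Context: Simplification of a formula with respect to a partial assignment $\mathcal{A}$ (and $\Phi_{\mathcal{A}}$ denotes the simplification of $\Phi$): delete every clause containing a literal made true by $\mathcal{A}$, and remove every literal made false; formulas are viewed as sets of clauses. Coupling procedure: the variables of $\Phi$ are labeled marked/unmarked by a fixed labeling. The procedure maintains two partial assignments $\mathcal{A}_1,\mathcal{A}_2$ (always setting the same set of variables), a partition $V_I\cup V_O$ of the variables, and a set of remaining clauses (initially all clauses). For $i=1,2$, $\mathcal{D}_i$ denotes the uniform distribution on satisfying assignments of $\Phi$ consistent with the current $\mathcal{A}_i$. Initially $\mathcal{A}_1(x)=T$, $\mathcal{A}_2(x)=F$, $V_I=\{x\}$, $V_O$ = all other variables. While there is a remaining clause $c$ with a variable in $V_I$ and a variable in $V_O$ (chosen by a fixed deterministic rule): its unset marked variables are set one at a time; to set $y$, let $p_i=\Pr_{\mathcal{D}_i}[y=T]$ and choose $(\mathcal{A}_1(y),\mathcal{A}_2(y))$ to be $(T,T)$ with probability $\min(p_1,p_2)$, $(F,F)$ with probability $\min(1-p_1,1-p_2)$, and otherwise $(T,F)$ if $p_1>p_2$ or $(F,T)$ if $p_1\le p_2$. Then: Case 1, if $c$ is satisfied by the variables already set in $\mathcal{A}_1$ and also in $\mathcal{A}_2$, let $S$ be the variables of $c$ with different values in $\mathcal{A}_1$ and $\mathcal{A}_2$, set $V_I\leftarrow V_I\cup S$, $V_O\leftarrow V_O\setminus S$, and delete $c$; Case 2, otherwise, let $S$ be all variables of $c$ and set $V_I\leftarrow V_I\cup S$, $V_O\leftarrow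 V_O\setminus S$. The procedure ends when no such clause exists. -}

module Defs where

open import Data.Nat using (ℕ; zero; suc; _*_; _<_)
open import Data.Bool using (Bool; true; false; not; _∧_; _∨_; if_then_else_)
open import Data.Fin using (Fin; _≟_)
open import Data.Maybe using (Maybe; just; nothing)
open import Data.Product using (_×_; _,_; proj₁; proj₂; Σ; ∃)
open import Data.List using (List; []; _∷_; map; length; filterᵇ; allFin; lookup; _++_)
open import Data.Bool.ListAction using (any; all)
open import Data.List.Relation.Unary.Any using (Any)
open import Data.List.Membership.Propositional using (_∈_)
open import Data.Vec as Vec using (Vec)
open import Relation.Nullary using (¬_)
open import Relation.Nullary.Decidable using (⌊_⌋)
open import Relation.Binary.PropositionalEquality using (_≡_; _≢_)
open import Function.Bundles using (_⇔_)

-- literal (v , b): b = true means the positive literal v, b = false means ¬v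
Literal : ℕ → Set
Literal n = Fin n × Bool

Clause : ℕ → Set
Clause n = List (Literal n)

CNF : ℕ → Set
CNF n = List (Clause n)

vars : ∀ {n} → Clause n → List (Fin n)
vars = map proj₁

eqB : Bool → Bool → Bool
eqB true b = b
eqB false b = not b

memB : ∀ {n} → Fin n → List (Fin n) → Bool
memB v = any (λ u → ⌊ u ≟ v ⌋)

Assignment : ℕ → Set
Assignment n = Vec Bool n

allAssignments : ∀ n → List (Assignment n)
allAssignments zero = Vec.[] ∷ []
allAssignments (suc n) =
  (map (true Vec.∷_) (allAssignments n)) ++ (map (false Vec.∷_) (allAssignments n))

satClause : ∀ {n} → Assignment n → Clause n → Bool
satClause σ = any (λ l → eqB (Vec.lookup σ (proj₁ l)) (proj₂ l))

satCNF : ∀ {n} → Assignment n → CNF n → Bool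
satCNF σ = all (satClause σ)

PAssign : ℕ → Set
PAssign n = Fin n → Maybe Bool

agrees : Maybe Bool → Bool → Bool
agrees nothing b = true
agrees (just a) b = eqB a b

consistent : ∀ {n} → Assignment n → PAssign n → Bool
consistent {n} σ A = all (λ v → agrees (A v) (Vec.lookup σ v)) (allFin n)

isSet : Maybe Bool → Bool
isSet nothing = false
isSet (just _) = true

sameVal : Maybe Bool → Maybe Bool → Bool
sameVal nothing nothing = true
sameVal (just a) (just b) = eqB a b
sameVal _ _ = false

update : ∀ {n} → PAssign n → Fin n → Bool → PAssign n
update A y b v = if ⌊ v ≟ y ⌋ then just b else A v

countSat : ∀ {n} → CNF n → PAssign n → ℕ
countSat {n} Φ A = length (filterᵇ (λ σ → satCNF σ Φ ∧ consistent σ A) (allAssignments n))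

-- number of those with y = T;  Pr_{D_A}[y = T] = countSatT / countSat
countSatT : ∀ {n} → CNF n → PAssign n → Fin n → ℕ
countSatT {n} Φ A y =
  length (filterᵇ (λ σ → satCNF σ Φ ∧ consistent σ A ∧ Vec.lookup σ y) (allAssignments n))

litTrue : ∀ {n} → PAssign n → Literal n → Bool
litTrue A (v , b) = sameVal (A v) (just b)

litFalse : ∀ {n} → PAssign n → Literal n → Bool
litFalse A (v , b) = sameVal (A v) (just (not b))

satByPartial : ∀ {n} → PAssign n → Clause n → Bool
satByPartial A = any (litTrue A)

simplify : ∀ {n} → PAssign n → CNF n → CNF n
simplify A Φ = map (filterᵇ (λ l → not (litFalse A l)))
                   (filterᵇ (λ c → not (satByPartial A c)) Φ)

ClauseEq : ∀ {n} → Clause n → Clause n → Set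
ClauseEq c d = ∀ l → (l ∈ c) ⇔ (l ∈ d)

_⊑_ : ∀ {n} → CNF n → CNF n → Set
Φ ⊑ Ψ = ∀ {c} → c ∈ Φ → Any (ClauseEq c) Ψ

infix 4 _≈F_
_≈F_ : ∀ {n} → CNF n → CNF n → Set
Φ ≈F Ψ = (Φ ⊑ Ψ) × (Ψ ⊑ Φ)

_∧F_ : ∀ {n} → CNF n → CNF n → CNF n
Φ ∧F Ψ = Φ ++ Ψ
infixr 6 _∧F_

-- the coupling procedure (support of the coupling)

module Coupling {n : ℕ} (Φ : CNF n) (marked : Fin n → Bool) where

  Idx : Set
  Idx = Fin (length Φ)

  record State : Set where
    constructor st
    field
      A₁ A₂ : PAssign n
      VI    : Fin n → Bool          -- true: in V_I, false: in V_O
      rem   : Idx → Bool            -- true: clause not yet deleted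
  open State public

  initial : Fin n → State
  initial x = st (λ v → if ⌊ v ≟ x ⌋ then just true else nothing)
                 (λ v → if ⌊ v ≟ x ⌋ then just false else nothing)
                 (λ v → ⌊ v ≟ x ⌋)
                 (λ _ → true)

  -- the pair (b₁ , b₂) has positive probability when setting y,
  -- where p_i = countSatT Φ A_i y / countSat Φ A_i
  Allowed : PAssign n → PAssign n → Fin n → Bool → Bool → Set
  Allowed A₁ A₂ y true  true  = (0 < countSatT Φ A₁ y) × (0 < countSatT Φ A₂ y)
  Allowed A₁ A₂ y false false = (countSatT Φ A₁ y < countSat Φ A₁) × (countSatT Φ A₂ y < countSat Φ A₂)
  Allowed A₁ A₂ y true  false =            -- p₁ > p₂
    countSatT Φ A₂ y * countSat Φ A₁ < countSatT Φ A₁ y * countSat Φ A₂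
  Allowed A₁ A₂ y false true  =            -- p₁ < p₂ (i.e. p₁ ≤ p₂ with positive probability)
    countSatT Φ A₁ y * countSat Φ A₂ < countSatT Φ A₂ y * countSat Φ A₁

  -- setting the unset marked variables of clause c one at a time (any order)
  data Fill (c : Clause n) : PAssign n → PAssign n → PAssign n → PAssign n → Set where
    done : ∀ {A₁ A₂} →
           (∀ {y} → y ∈ vars c → marked y ≡ true → isSet (A₁ y) ≡ true) →
           Fill c A₁ A₂ A₁ A₂
    set  : ∀ {A₁ A₂ B₁ B₂} y b₁ b₂ →
           y ∈ vars c → marked y ≡ true → isSet (A₁ y) ≡ false →
           Allowed A₁ A₂ y b₁ b₂ →
           Fill c (update A₁ y b₁) (update A₂ y b₂) B₁ B₂ →
           Fill c A₁ A₂ B₁ B₂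

  Eligible : State → Idx → Set
  Eligible s j = (rem s j ≡ true)
               × Any (λ u → VI s u ≡ true) (vars (lookup Φ j))
               × Any (λ w → VI s w ≡ false) (vars (lookup Φ j))

  finish : State → Idx → PAssign n → PAssign n → State
  finish s j B₁ B₂ =
    if satByPartial B₁ c ∧ satByPartial B₂ c
    then st B₁ B₂ (λ v → VI s v ∨ (memB v (vars c) ∧ not (sameVal (B₁ v) (B₂ v))))
                  (λ i → rem s i ∧ not ⌊ i ≟ j ⌋)
    else st B₁ B₂ (λ v → VI s v ∨ memB v (vars c)) (rem s)
    where c = lookup Φ j

  data Step : State → State → Set where
    step : ∀ {s B₁ B₂} (j : Idx) → Eligible s j →
           Fill (lookup Φ j) (A₁ s) (A₂ s) B₁ B₂ →
           Step s (finish s j B₁ B₂)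

  -- reflexive-transitive closure: all runs (the clause-choice rule being arbitrary)
  data Reach (x : Fin n) : State → Set where
    start : Reach x (initial x)
    next  : ∀ {s t} → Reach x s → Step s t → Reach x t

  Terminal : State → Set
  Terminal s = ∀ j → ¬ Eligible s j

  remainingIn : State → Bool → CNF n
  remainingIn s b = map (lookup Φ)
    (filterᵇ (λ j → rem s j ∧ all (λ v → eqB (VI s v) b) (vars (lookup Φ j))) (allFin (length Φ)))

module Submission where

-- Every reachable state of the coupling procedure satisfies three invariants:
--   (a) A₁ and A₂ set the same variables;
--   (b) A₁ and A₂ agree on every variable of V_O;
--   (c) every deleted clause is satisfied by the set variables of A₁ and of A₂.
-- They hold initially (only x is set, and x ∈ V_I) and every step preserves them:
-- filling a clause c only sets unset variables of c, so both assignments are extended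
-- (satisfied clauses stay satisfied) with equal domains; Case 2 moves all of c into V_I;
-- Case 1 moves into V_I exactly the variables of c on which A₁ and A₂ differ, and deletes c
-- only when both assignments satisfy it.  At a terminal state every remaining clause lies
-- entirely in V_I or entirely in V_O.  So by (c) a clause of Φ not satisfied by A_i is
-- remaining, hence in C_I or C_O, which splits Φ_{A_i} into Φ_{I_i} ∧ the simplification of
-- C_O; and by (b) the simplifications of C_O with respect to A₁ and A₂ coincide.

open import Defs
open import Data.Nat using (ℕ)
open import Data.Bool using (Bool; true; false; not; _∧_; _∨_; T)
open import Data.Bool.Properties using (T?; T-≡; ∨-conicalˡ; ∨-conicalʳ; ∧-identityʳ; not-injective)
open import Data.Bool.ListAction using (any; all)
open import Data.Fin using (Fin; _≟_)
open import Data.Vec using (lookup)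
open import Data.Maybe using (just; nothing)
open import Data.Product using (_×_; ∃; _,_; proj₁; proj₂)
open import Data.Sum using (_⊎_; inj₁; inj₂)
open import Data.Empty using (⊥-elim)
open import Data.List using (List; []; _∷_; map; filterᵇ; allFin; length)
import Data.List as List
open import Data.List.Properties using (map-cong-local)
open import Data.List.Relation.Unary.Any using (Any; here; there; index)
import Data.List.Relation.Unary.Any as Any
import Data.List.Relation.Unary.All as All
open import Data.List.Relation.Unary.Any.Properties using (lookup-index; any⁺; any⁻)
open import Data.List.Relation.Unary.All.Properties using (all⁺)
open import Data.List.Membership.Propositional using (_∈_; find; lose)
open import Data.List.Membership.Propositional.Properties
  using (∈-map⁺; ∈-map⁻; ∈-filter⁺; ∈-filter⁻; ∈-lookup; ∈-allFin; ∈-++⁺ˡ; ∈-++⁺ʳ; ∈-++⁻)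
open import Data.List.Relation.Binary.Subset.Propositional using (_⊆_)
open import Relation.Nullary using (yes; no)
open import Relation.Nullary.Decidable using (⌊_⌋; dec-true; isYes≗does)
open import Relation.Binary.PropositionalEquality
open import Function using (_∘_)
open import Function.Bundles using (Equivalence; mk⇔)

private
  T⇒≡ : ∀ {b} → T b → b ≡ true
  T⇒≡ = Equivalence.to T-≡

  ≡⇒T : ∀ {b} → b ≡ true → T b
  ≡⇒T = Equivalence.from T-≡

∧-true⁻ : ∀ {a b} → a ∧ b ≡ true → a ≡ true × b ≡ true
∧-true⁻ {true} {true} _ = refl , refl

not-true⁻ : ∀ {a} → not a ≡ true → a ≡ false
not-true⁻ {false} _ = refl

eqB⇒≡ : ∀ {a b} → eqB a b ≡ true → a ≡ b
eqB⇒≡ {true} {true} _ = refl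
eqB⇒≡ {false} {false} _ = refl

eqB-false⁻ : ∀ {a b} → eqB a b ≡ false → a ≡ not b
eqB-false⁻ {true} {false} _ = refl
eqB-false⁻ {false} {true} _ = refl

sameVal⇒≡ : ∀ {a₁ a₂} → sameVal a₁ a₂ ≡ true → a₁ ≡ a₂
sameVal⇒≡ {nothing} {nothing} _ = refl
sameVal⇒≡ {just a} {just b} h = cong just (eqB⇒≡ h)

module _ {A : Set} (p : A → Bool) where

  ∈-filterᵇ⁺ : ∀ {x xs} → x ∈ xs → p x ≡ true → x ∈ filterᵇ p xs
  ∈-filterᵇ⁺ x∈xs px = ∈-filter⁺ (T? ∘ p) x∈xs (≡⇒T px)

  ∈-filterᵇ⁻ : ∀ {x xs} → x ∈ filterᵇ p xs → x ∈ xs × p x ≡ true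
  ∈-filterᵇ⁻ x∈ with ∈-filter⁻ (T? ∘ p) x∈
  ... | x∈xs , px = x∈xs , T⇒≡ px

  any-intro : ∀ {x xs} → x ∈ xs → p x ≡ true → any p xs ≡ true
  any-intro x∈xs px = T⇒≡ (any⁺ p (lose x∈xs (≡⇒T px)))

  any-witness : ∀ xs → any p xs ≡ true → ∃ λ x → x ∈ xs × p x ≡ true
  any-witness xs h with find (any⁻ p xs (≡⇒T h))
  ... | x , x∈xs , px = x , x∈xs , T⇒≡ px

  all-elim : ∀ {x xs} → all p xs ≡ true → x ∈ xs → p x ≡ true
  all-elim {xs = xs} h x∈xs = T⇒≡ (All.lookup (all⁺ p xs (≡⇒T h)) x∈xs)

  all-counterexample : ∀ xs → all p xs ≡ false → Any (λ x → p x ≡ false) xs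
  all-counterexample (x ∷ xs) h with p x in px
  ... | false = here px
  ... | true  = there (all-counterexample xs h)

  any-cong-local : ∀ {q} xs → (∀ {x} → x ∈ xs → p x ≡ q x) → any p xs ≡ any q xs
  any-cong-local []       _ = refl
  any-cong-local (x ∷ xs) h = cong₂ _∨_ (h (here refl)) (any-cong-local xs (h ∘ there))

  filterᵇ-cong-local : ∀ {q} xs → (∀ {x} → x ∈ xs → p x ≡ q x) → filterᵇ p xs ≡ filterᵇ q xs
  filterᵇ-cong-local {q} (x ∷ xs) h with p x | q x | h (here refl)
  ... | true  | true  | refl = cong (x ∷_) (filterᵇ-cong-local xs (h ∘ there))
  ... | false | false | refl = filterᵇ-cong-local xs (h ∘ there)
  filterᵇ-cong-local [] _ = refl

lookup-elim : ∀ {A : Set} {xs : List A} (P : A → Set) →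
              (∀ i → P (List.lookup xs i)) → ∀ {x} → x ∈ xs → P x
lookup-elim P h x∈xs = subst P (sym (lookup-index x∈xs)) (h (index x∈xs))

memB-∈ : ∀ {n} {v : Fin n} {vs} → v ∈ vs → memB v vs ≡ true
memB-∈ {v = v} v∈vs =
  any-intro (λ u → ⌊ u ≟ v ⌋) v∈vs (trans (isYes≗does (v ≟ v)) (dec-true (v ≟ v) refl))

memB-false⇒≢ : ∀ {n} {v y : Fin n} {vs} → memB v vs ≡ false → y ∈ vs → v ≢ y
memB-false⇒≢ v∉vs y∈vs refl with () ← trans (sym (memB-∈ y∈vs)) v∉vs

Extends : ∀ {n} → PAssign n → PAssign n → Set
Extends A B = ∀ v a → A v ≡ just a → B v ≡ just a

extends-refl : ∀ {n} {A : PAssign n} → Extends A A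
extends-refl _ _ Av = Av

extends-trans : ∀ {n} {A B C : PAssign n} → Extends A B → Extends B C → Extends A C
extends-trans A≼B B≼C v a Av = B≼C v a (A≼B v a Av)

update-extends : ∀ {n} {A : PAssign n} y b → isSet (A y) ≡ false → Extends A (update A y b)
update-extends y b unset v a Av with v ≟ y
... | no _ = Av
... | yes refl with () ← trans (sym (cong isSet Av)) unset

update-elsewhere : ∀ {n} (A : PAssign n) {y v} b → v ≢ y → update A y b v ≡ A v
update-elsewhere A {y} {v} b v≢y with v ≟ y
... | no _ = refl
... | yes v≡y = ⊥-elim (v≢y v≡y)

litTrue-mono : ∀ {n} {A B : PAssign n} → Extends A B → ∀ l → litTrue A l ≡ true → litTrue B l ≡ true
litTrue-mono {A = A} A≼B (v , b) h with A v in Av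
... | just a rewrite A≼B v a Av = h

satByPartial-mono : ∀ {n} {A B : PAssign n} → Extends A B →
                    ∀ c → satByPartial A c ≡ true → satByPartial B c ≡ true
satByPartial-mono {A = A} {B} A≼B c h with any-witness (litTrue A) c h
... | l , l∈c , lTrue = any-intro (litTrue B) l∈c (litTrue-mono A≼B l lTrue)

SameDomain : ∀ {n} → PAssign n → PAssign n → Set
SameDomain A₁ A₂ = ∀ v → isSet (A₁ v) ≡ isSet (A₂ v)

update-sameDomain : ∀ {n} {A₁ A₂ : PAssign n} y b₁ b₂ → SameDomain A₁ A₂ →
                    SameDomain (update A₁ y b₁) (update A₂ y b₂)
update-sameDomain y _ _ same v with v ≟ y
... | yes _ = refl
... | no _  = same v

reduce : ∀ {n} → PAssign n → Clause n → Clause n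
reduce A = filterᵇ (λ l → not (litFalse A l))

⊆⇒⊑ : ∀ {n} {Φ Ψ : CNF n} → Φ ⊆ Ψ → Φ ⊑ Ψ
⊆⇒⊑ Φ⊆Ψ c∈Φ = Any.map (λ { refl l → mk⇔ (λ z → z) (λ z → z) }) (Φ⊆Ψ c∈Φ)

≈F-reflexive : ∀ {n} {Φ Ψ : CNF n} → Φ ≡ Ψ → Φ ≈F Ψ
≈F-reflexive refl = ⊆⇒⊑ (λ z → z) , ⊆⇒⊑ (λ z → z)

∈-simplify⁺ : ∀ {n} (A : PAssign n) {Ψ c} → c ∈ Ψ → satByPartial A c ≡ false →
              reduce A c ∈ simplify A Ψ
∈-simplify⁺ A c∈Ψ unsat =
  ∈-map⁺ (reduce A) (∈-filterᵇ⁺ (λ c → not (satByPartial A c)) c∈Ψ (cong not unsat))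

∈-simplify⁻ : ∀ {n} (A : PAssign n) {Ψ d} → d ∈ simplify A Ψ →
              ∃ λ c → c ∈ Ψ × satByPartial A c ≡ false × d ≡ reduce A c
∈-simplify⁻ A d∈ with ∈-map⁻ (reduce A) d∈
... | c , c∈ , refl with ∈-filterᵇ⁻ (λ c → not (satByPartial A c)) c∈
... | c∈Ψ , unsat = c , c∈Ψ , not-true⁻ unsat , refl

simplify-mono : ∀ {n} (A : PAssign n) {Ψ Ψ'} → Ψ ⊆ Ψ' → simplify A Ψ ⊆ simplify A Ψ'
simplify-mono A Ψ⊆Ψ' d∈ with ∈-simplify⁻ A d∈
... | c , c∈Ψ , unsat , refl = ∈-simplify⁺ A (Ψ⊆Ψ' c∈Ψ) unsat

simplify-split : ∀ {n} (A : PAssign n) {Ψ Ψ₁ Ψ₂} → Ψ₁ ⊆ Ψ → Ψ₂ ⊆ Ψ →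
                 (∀ {c} → c ∈ Ψ → satByPartial A c ≡ false → c ∈ Ψ₁ ⊎ c ∈ Ψ₂) →
                 simplify A Ψ ≈F simplify A Ψ₁ ∧F simplify A Ψ₂
simplify-split A {Ψ} {Ψ₁} {Ψ₂} Ψ₁⊆Ψ Ψ₂⊆Ψ cover = ⊆⇒⊑ into , ⊆⇒⊑ outof
  where
    into : simplify A Ψ ⊆ simplify A Ψ₁ ∧F simplify A Ψ₂
    into d∈ with ∈-simplify⁻ A d∈
    ... | c , c∈Ψ , unsat , refl with cover c∈Ψ unsat
    ... | inj₁ c∈Ψ₁ = ∈-++⁺ˡ (∈-simplify⁺ A c∈Ψ₁ unsat)
    ... | inj₂ c∈Ψ₂ = ∈-++⁺ʳ (simplify A Ψ₁) (∈-simplify⁺ A c∈Ψ₂ unsat)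

    outof : simplify A Ψ₁ ∧F simplify A Ψ₂ ⊆ simplify A Ψ
    outof d∈ with ∈-++⁻ (simplify A Ψ₁) d∈
    ... | inj₁ d∈₁ = simplify-mono A Ψ₁⊆Ψ d∈₁
    ... | inj₂ d∈₂ = simplify-mono A Ψ₂⊆Ψ d∈₂

simplify-agree : ∀ {n} {A₁ A₂ : PAssign n} {Ψ} →
                 (∀ {c} → c ∈ Ψ → ∀ {l} → l ∈ c → A₁ (proj₁ l) ≡ A₂ (proj₁ l)) →
                 simplify A₁ Ψ ≡ simplify A₂ Ψ
simplify-agree {A₁ = A₁} {A₂} {Ψ} agree = begin
    map (reduce A₁) (filterᵇ (unsat A₁) Ψ)
  ≡⟨ cong (map (reduce A₁)) (filterᵇ-cong-local (unsat A₁) Ψ same-unsat) ⟩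
    map (reduce A₁) (filterᵇ (unsat A₂) Ψ)
  ≡⟨ map-cong-local (All.tabulate (same-reduce ∘ proj₁ ∘ ∈-filterᵇ⁻ (unsat A₂))) ⟩
    map (reduce A₂) (filterᵇ (unsat A₂) Ψ)
  ∎
  where
    open ≡-Reasoning
    unsat : PAssign _ → Clause _ → Bool
    unsat A c = not (satByPartial A c)

    same-unsat : ∀ {c} → c ∈ Ψ → unsat A₁ c ≡ unsat A₂ c
    same-unsat {c} c∈Ψ = cong not (any-cong-local (litTrue A₁) c
      (λ {l} l∈c → cong (λ a → sameVal a (just (proj₂ l))) (agree c∈Ψ l∈c)))

    same-reduce : ∀ {c} → c ∈ Ψ → reduce A₁ c ≡ reduce A₂ c
    same-reduce {c} c∈Ψ = filterᵇ-cong-local (λ l → not (litFalse A₁ l)) c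
      (λ {l} l∈c → cong (λ a → not (sameVal a (just (not (proj₂ l))))) (agree c∈Ψ l∈c))

module CouplingInvariant {n : ℕ} (Φ : CNF n) (marked : Fin n → Bool) where
  open Coupling Φ marked

  clause : Idx → Clause n
  clause = List.lookup Φ

  record Invariant (s : State) : Set where
    field
      sameDomain       : SameDomain (A₁ s) (A₂ s)
      agreeOutside     : ∀ v → VI s v ≡ false → A₁ s v ≡ A₂ s v
      deletedSatisfied : ∀ j → rem s j ≡ false →
                         satByPartial (A₁ s) (clause j) ≡ true × satByPartial (A₂ s) (clause j) ≡ true
  open Invariant

  record FillEffect (c : Clause n) (A₁ A₂ B₁ B₂ : PAssign n) : Set where
    field
      sameDomainAfter : SameDomain B₁ B₂
      extends₁        : Extends A₁ B₁
      extends₂        : Extends A₂ B₂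
      untouched       : ∀ v → memB v (vars c) ≡ false → B₁ v ≡ A₁ v × B₂ v ≡ A₂ v
  open FillEffect

  fill-effect : ∀ {c A₁ A₂ B₁ B₂} → Fill c A₁ A₂ B₁ B₂ → SameDomain A₁ A₂ → FillEffect c A₁ A₂ B₁ B₂
  fill-effect (done _) same = record
    { sameDomainAfter = same ; extends₁ = extends-refl ; extends₂ = extends-refl
    ; untouched = λ _ _ → refl , refl }
  fill-effect {A₁ = P₁} {A₂ = P₂} (set y b₁ b₂ y∈c _ unset _ rest) same = record
    { sameDomainAfter = sameDomainAfter E
    ; extends₁ = extends-trans (update-extends y b₁ unset) (extends₁ E)
    ; extends₂ = extends-trans (update-extends y b₂ (trans (sym (same y)) unset)) (extends₂ E)
    ; untouched = λ v v∉c →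
        let B₁v , B₂v = untouched E v v∉c
            v≢y = memB-false⇒≢ v∉c y∈c
        in trans B₁v (update-elsewhere P₁ b₁ v≢y) , trans B₂v (update-elsewhere P₂ b₂ v≢y) }
    where E = fill-effect rest (update-sameDomain y b₁ b₂ same)

  module _ {s : State} {c : Clause n} {B₁ B₂ : PAssign n}
           (inv : Invariant s) (F : FillEffect c (A₁ s) (A₂ s) B₁ B₂) where

    agree-untouched : ∀ v → VI s v ≡ false → memB v (vars c) ≡ false → B₁ v ≡ B₂ v
    agree-untouched v v∈O v∉c = begin
        B₁ v    ≡⟨ proj₁ (untouched F v v∉c) ⟩
        A₁ s v  ≡⟨ agreeOutside inv v v∈O ⟩
        A₂ s v  ≡⟨ proj₂ (untouched F v v∉c) ⟨
        B₂ v    ∎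
      where open ≡-Reasoning

    deleted-still-satisfied : ∀ i → rem s i ≡ false →
      satByPartial B₁ (clause i) ≡ true × satByPartial B₂ (clause i) ≡ true
    deleted-still-satisfied i del with deletedSatisfied inv i del
    ... | sat₁ , sat₂ = satByPartial-mono (extends₁ F) (clause i) sat₁
                      , satByPartial-mono (extends₂ F) (clause i) sat₂

  step-preserves : ∀ {s t} → Invariant s → Step s t → Invariant t
  step-preserves {s} inv (step {B₁ = B₁} {B₂} j _ fill) =
    by-case (fill-effect fill (sameDomain inv))
    where
      c = clause j

      by-case : FillEffect c (A₁ s) (A₂ s) B₁ B₂ → Invariant (finish s j B₁ B₂)
      by-case F with satByPartial B₁ c ∧ satByPartial B₂ c in bothSat
      ... | true = record
        { sameDomain = sameDomainAfter F ; agreeOutside = agree₁ ; deletedSatisfied = deleted₁ }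
        where
          agree₁ : ∀ v → (VI s v ∨ (memB v (vars c) ∧ not (sameVal (B₁ v) (B₂ v)))) ≡ false → B₁ v ≡ B₂ v
          agree₁ v h with memB v (vars c) in v∈?c
          ... | false = agree-untouched inv F v (∨-conicalˡ _ _ h) v∈?c
          ... | true  = sameVal⇒≡ (not-injective (∨-conicalʳ _ _ h))

          deleted₁ : ∀ i → (rem s i ∧ not ⌊ i ≟ j ⌋) ≡ false →
                     satByPartial B₁ (clause i) ≡ true × satByPartial B₂ (clause i) ≡ true
          deleted₁ i h with i ≟ j
          ... | yes refl = ∧-true⁻ bothSat
          ... | no _     = deleted-still-satisfied inv F i (trans (sym (∧-identityʳ (rem s i))) h)
      ... | false = record
        { sameDomain = sameDomainAfter F
        ; agreeOutside = λ v h → agree-untouched inv F v (∨-conicalˡ _ _ h) (∨-conicalʳ _ _ h)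
        ; deletedSatisfied = deleted-still-satisfied inv F }

  initial-invariant : ∀ x → Invariant (initial x)
  initial-invariant x = record
    { sameDomain = same ; agreeOutside = agree ; deletedSatisfied = λ _ () }
    where
      same : SameDomain (A₁ (initial x)) (A₂ (initial x))
      same v with v ≟ x
      ... | yes _ = refl
      ... | no _  = refl

      agree : ∀ v → ⌊ v ≟ x ⌋ ≡ false → A₁ (initial x) v ≡ A₂ (initial x) v
      agree v v≢x with v ≟ x
      ... | no _ = refl

  reach-invariant : ∀ {x s} → Reach x s → Invariant s
  reach-invariant {x} start = initial-invariant x
  reach-invariant (next r s→t) = step-preserves (reach-invariant r) s→t

  remainingIn-⊆ : ∀ s b → remainingIn s b ⊆ Φ
  remainingIn-⊆ s b c∈ with ∈-map⁻ clause c∈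
  ... | j , _ , refl = ∈-lookup j

  onSide : State → Bool → Idx → Bool
  onSide s b j = rem s j ∧ all (λ v → eqB (VI s v) b) (vars (clause j))

  ∈-remainingIn : ∀ s b j → rem s j ≡ true → all (λ v → eqB (VI s v) b) (vars (clause j)) ≡ true →
                  clause j ∈ remainingIn s b
  ∈-remainingIn s b j r side = ∈-map⁺ clause (∈-filterᵇ⁺ (onSide s b) (∈-allFin j) (cong₂ _∧_ r side))

  terminal-one-side : ∀ s → Terminal s → ∀ j → rem s j ≡ true →
                      clause j ∈ remainingIn s true ⊎ clause j ∈ remainingIn s false
  terminal-one-side s term j r
    with all (λ v → eqB (VI s v) true) (vars (clause j)) in inI
       | all (λ v → eqB (VI s v) false) (vars (clause j)) in inO
  ... | true  | _     = inj₁ (∈-remainingIn s true j r inI)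
  ... | false | true  = inj₂ (∈-remainingIn s false j r inO)
  ... | false | false = ⊥-elim (term j (r , witness inO , witness inI))
    where
      witness : ∀ {b} → all (λ v → eqB (VI s v) b) (vars (clause j)) ≡ false →
                Any (λ v → VI s v ≡ not b) (vars (clause j))
      witness h = Any.map eqB-false⁻ (all-counterexample _ _ h)

  remainingOut-agree : ∀ {s} → Invariant s → ∀ {c} → c ∈ remainingIn s false →
                       ∀ {l} → l ∈ c → A₁ s (proj₁ l) ≡ A₂ s (proj₁ l)
  remainingOut-agree {s} inv c∈ {l} l∈c with ∈-map⁻ clause c∈
  ... | j , j∈ , refl with ∈-filterᵇ⁻ (onSide s false) {xs = allFin (length Φ)} j∈
  ... | _ , selected = agreeOutside inv (proj₁ l)
          (eqB⇒≡ (all-elim (λ v → eqB (VI s v) false) (proj₂ (∧-true⁻ selected)) (∈-map⁺ proj₁ l∈c)))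

  terminal-split : ∀ s → Terminal s → (A : PAssign n) →
                   (∀ j → rem s j ≡ false → satByPartial A (clause j) ≡ true) →
                   simplify A Φ ≈F simplify A (remainingIn s true) ∧F simplify A (remainingIn s false)
  terminal-split s term A deleted =
    simplify-split A (remainingIn-⊆ s true) (remainingIn-⊆ s false) (lookup-elim _ unsatisfied)
    where
      unsatisfied : ∀ j → satByPartial A (clause j) ≡ false →
                    clause j ∈ remainingIn s true ⊎ clause j ∈ remainingIn s false
      unsatisfied j unsat with rem s j in r
      ... | true  = terminal-one-side s term j r
      ... | false with () ← trans (sym (deleted j r)) unsat

-- The satisfiability hypotheses of the paper (Φ has models with x = T and with x = F) only
-- ensure that the coupled distributions are well defined; the decomposition does not need them.
lemma3p6 : {n : ℕ} (Φ : CNF n) (x : Fin n) (marked : Fin n → Bool) →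
    (∃ λ σ → (satCNF σ Φ ≡ true) × (lookup σ x ≡ true)) →
    (∃ λ σ → (satCNF σ Φ ≡ true) × (lookup σ x ≡ false)) →
    ∀ (s : Coupling.State Φ marked) →
    Coupling.Reach Φ marked x s → Coupling.Terminal Φ marked s →
    let A₁ = Coupling.State.A₁ s
        A₂ = Coupling.State.A₂ s
        CI = Coupling.remainingIn Φ marked s true
        CO = Coupling.remainingIn Φ marked s false
    in (simplify A₁ CO ≈F simplify A₂ CO)
     × (simplify A₁ Φ ≈F simplify A₁ CI ∧F simplify A₁ CO)
     × (simplify A₂ Φ ≈F simplify A₂ CI ∧F simplify A₁ CO)
lemma3p6 Φ x marked _ _ s reach term =
    ≈F-reflexive sameCO
  , terminal-split s term (A₁ s) (λ j del → proj₁ (deletedSatisfied inv j del))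
  , subst (λ Ψ → simplify (A₂ s) Φ ≈F simplify (A₂ s) (remainingIn s true) ∧F Ψ) (sym sameCO)
          (terminal-split s term (A₂ s) (λ j del → proj₂ (deletedSatisfied inv j del)))
  where
    open Coupling Φ marked
    open CouplingInvariant Φ marked
    open Invariant

    inv : Invariant s
    inv = reach-invariant reach

    sameCO : simplify (A₁ s) (remainingIn s false) ≡ simplify (A₂ s) (remainingIn s false)
    sameCO = simplify-agree (remainingOut-agree inv)
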